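{- Let $G$ be a simple, connected, undirected graph with vertex set $V=\{1,\ldots,n\}$ and family of maximal independent sets $\mathscr{M}$. For every $v\in V$ there exists $A\in\mathscr{M}$ with $v\in A$ such that either $A\setminus Int(A)=\{v\}$ or $Int(A)=A$.
   Context: The labels give the linear order on $V$; $N(v)$ is the neighbourhood of $v$. For an independent set $A$ and $v\in A$, $Subs(v)=\{u\in N(v): (A\setminus\{v\})\cup\{u\}\text{ independent}\}$; $v$ is internally active in $A$ if $Subs(v)=\emptyset$ or $v>\max Subs(v)$; $Int(A)$ is the set of internally active vertices of $A$. -}

module Defs where

open import Data.Nat using (ℕ)
open import Data.Fin using (Fin; _<_)
open import Data.Fin.Subset using (Subset; _∈_; _∉_; _∪_; ⁅_⁆; _-_)
open import Data.Product using (_×_)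
open import Relation.Nullary using (¬_; Dec)
open import Relation.Binary.PropositionalEquality using (_≡_)
open import Relation.Binary.Construct.Closure.ReflexiveTransitive using (Star)
open import Function.Bundles using (_⇔_)

-- A simple undirected graph on the vertex set Fin n (vertices ordered as in Fin n,
-- i.e. the labels 1..n correspond to 0..n-1 with the same linear order).
record Graph (n : ℕ) : Set₁ where
  field
    Adj   : Fin n → Fin n → Set
    sym   : ∀ {u v} → Adj u v → Adj v u
    irrefl : ∀ {v} → ¬ Adj v v
    dec   : ∀ u v → Dec (Adj u v)

open Graph public

Connected : ∀ {n} → Graph n → Set
Connected G = ∀ u v → Star (Adj G) u v

_∈N[_]_ : ∀ {n} → Fin n → Graph n → Fin n → Set
u ∈N[ G ] v = Adj G v u

Independent : ∀ {n} → Graph n → Subset n → Set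
Independent G A = ∀ u v → u ∈ A → v ∈ A → ¬ Adj G u v

MaximalIndependent : ∀ {n} → Graph n → Subset n → Set
MaximalIndependent G A =
  Independent G A × (∀ u → u ∉ A → ¬ Independent G (A ∪ ⁅ u ⁆))

InSubs : ∀ {n} → Graph n → Subset n → Fin n → Fin n → Set
InSubs G A v u = (u ∈N[ G ] v) × Independent G ((A - v) ∪ ⁅ u ⁆)

-- v internally active in A: Subs(v) = ∅ or v > max Subs(v),
-- i.e. every element of Subs(v) is smaller than v.
InternallyActive : ∀ {n} → Graph n → Subset n → Fin n → Set
InternallyActive G A v = v ∈ A × (∀ u → InSubs G A v u → u < v)

AllActive : ∀ {n} → Graph n → Subset n → Set
AllActive G A = ∀ w → w ∈ A → InternallyActive G A w

NonActiveIsSingleton : ∀ {n} → Graph n → Subset n → Fin n → Set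
NonActiveIsSingleton G A v =
  ∀ w → (w ∈ A × ¬ InternallyActive G A w) ⇔ (w ≡ v)

{-# OPTIONS --safe #-}
module Submission where

-- Build the set greedily from the largest vertex down, after putting v in and
-- excluding its neighbours: then every vertex u outside A is adjacent to v or
-- to a larger member of A.  If u can substitute for some w ∈ A other than v,
-- then u has no neighbour in A apart from w, so that neighbour is w itself and
-- u < w.  Hence every member except possibly v is internally active, which is
-- exactly the dichotomy of the theorem.

open import Defs
open import Data.Nat using (zero; suc; z≤n; s≤s)
open import Data.Fin using (Fin; zero; suc; _<_)
open import Data.Fin.Properties using (any?; all?; _≟_; _<?_)
open import Data.Fin.Subset using (Subset; _∈_; _∉_; _∪_; ⁅_⁆; _-_; inside; outside)
open import Data.Fin.Subset.Properties
  using (_∈?_; x∈p∪q⁻; x∈p∪q⁺; x∈⁅y⁆⇒x≡y; x∈⁅x⁆; x∈p∧x≢y⇒x∈p-y)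
open import Data.Vec using (_∷_; []; here; there)
open import Data.Product using (Σ; _×_; _,_; proj₁; proj₂)
open import Data.Sum using (_⊎_; inj₁; inj₂)
open import Data.Empty using (⊥-elim)
open import Function using (_∘_)
open import Relation.Nullary using (¬_; Dec; yes; no)
open import Relation.Nullary.Decidable using (_×-dec_; _⊎-dec_; _→-dec_; ¬?)
open import Relation.Unary using (Decidable)
open import Relation.Binary.PropositionalEquality using (_≡_; _≢_; refl)
open import Function.Bundles using (mk⇔)

dropFirst : ∀ {n} → Graph (suc n) → Graph n
dropFirst G = record
  { Adj    = λ u w → Adj G (suc u) (suc w)
  ; sym    = sym G
  ; irrefl = irrefl G
  ; dec    = λ u w → dec G (suc u) (suc w)
  }

independent? : ∀ {n} (G : Graph n) → Decidable (Independent G)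
independent? G S = all? λ u → all? λ w → (u ∈? S) →-dec ((w ∈? S) →-dec ¬? (dec G u w))

DominatedFromAbove : ∀ {n} → Graph n → (Fin n → Set) → Subset n → Fin n → Set
DominatedFromAbove {n} G Blocked A u =
  Blocked u ⊎ Σ (Fin n) λ w → w ∈ A × Adj G u w × u < w

record GreedyIndependent {n} (G : Graph n) (Blocked : Fin n → Set) (A : Subset n) : Set where
  field
    independent : Independent G A
    unblocked   : ∀ u → u ∈ A → ¬ Blocked u
    dominated   : ∀ u → u ∉ A → DominatedFromAbove G Blocked A u

open GreedyIndependent

dominatedFromAbove-∷ : ∀ {n} (G : Graph (suc n)) {Blocked : Fin (suc n) → Set} {A x} →
  GreedyIndependent (dropFirst G) (Blocked ∘ suc) A →
  ∀ u → suc u ∉ x ∷ A → DominatedFromAbove G Blocked (x ∷ A) (suc u)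
dominatedFromAbove-∷ G greedy u u∉ with dominated greedy u (u∉ ∘ there)
... | inj₁ blocked                = inj₁ blocked
... | inj₂ (w , w∈A , adj , u<w) = inj₂ (suc w , there w∈A , adj , s≤s u<w)

greedyIndependent : ∀ {n} (G : Graph n) {Blocked : Fin n → Set} → Decidable Blocked →
  Σ (Subset n) (GreedyIndependent G Blocked)
greedyIndependent {zero} G _ =
  [] , record { independent = λ () ; unblocked = λ () ; dominated = λ () }
greedyIndependent {suc n} G {Blocked} blocked? with greedyIndependent (dropFirst G) (blocked? ∘ suc)
... | A , greedy with blocked? zero ⊎-dec any? (λ w → (w ∈? A) ×-dec dec G zero (suc w))
... | yes excluded = outside ∷ A , record
  { independent = λ { (suc u) (suc w) (there u∈) (there w∈) → independent greedy u w u∈ w∈ }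
  ; unblocked   = λ { (suc u) (there u∈) → unblocked greedy u u∈ }
  ; dominated   = λ { zero _ → dominatedZero excluded
                    ; (suc u) u∉ → dominatedFromAbove-∷ G {Blocked} greedy u u∉ }
  }
  where
  dominatedZero : Blocked zero ⊎ Σ (Fin n) (λ w → w ∈ A × Adj G zero (suc w)) →
    DominatedFromAbove G Blocked (outside ∷ A) zero
  dominatedZero (inj₁ blocked)          = inj₁ blocked
  dominatedZero (inj₂ (w , w∈A , adj)) = inj₂ (suc w , there w∈A , adj , s≤s z≤n)
... | no ¬excluded = inside ∷ A , record
  { independent = independentZero
  ; unblocked   = λ { zero _ blocked → ¬excluded (inj₁ blocked)
                    ; (suc u) (there u∈) → unblocked greedy u u∈ }
  ; dominated   = λ { zero zero∉ → ⊥-elim (zero∉ here)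
                    ; (suc u) u∉ → dominatedFromAbove-∷ G {Blocked} greedy u u∉ }
  }
  where
  independentZero : Independent G (inside ∷ A)
  independentZero zero    zero    _          _          = irrefl G
  independentZero zero    (suc w) _          (there w∈) = λ adj → ¬excluded (inj₂ (w , w∈ , adj))
  independentZero (suc u) zero    (there u∈) _          = λ adj → ¬excluded (inj₂ (u , u∈ , sym G adj))
  independentZero (suc u) (suc w) (there u∈) (there w∈) = independent greedy u w u∈ w∈

module _ {n} (G : Graph n) where

  independent-∪⁅⁆ : ∀ {A v} → Independent G A → (∀ u → u ∈ A → ¬ Adj G v u) →
    Independent G (A ∪ ⁅ v ⁆)
  independent-∪⁅⁆ {A} {v} indA v≁A u w u∈ w∈
    with x∈p∪q⁻ A ⁅ v ⁆ u∈ | x∈p∪q⁻ A ⁅ v ⁆ w∈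
  ... | inj₁ u∈A | inj₁ w∈A = indA u w u∈A w∈A
  ... | inj₁ u∈A | inj₂ w∈v rewrite x∈⁅y⁆⇒x≡y v w∈v = v≁A u u∈A ∘ sym G
  ... | inj₂ u∈v | inj₁ w∈A rewrite x∈⁅y⁆⇒x≡y v u∈v = v≁A w w∈A
  ... | inj₂ u∈v | inj₂ w∈v rewrite x∈⁅y⁆⇒x≡y v u∈v | x∈⁅y⁆⇒x≡y v w∈v = irrefl G

  subs-∉ : ∀ {A w u} → Independent G A → w ∈ A → InSubs G A w u → u ∉ A
  subs-∉ {w = w} indA w∈A (adj , _) u∈A = indA w _ w∈A u∈A adj

  subs-nonadjacent : ∀ {A w u x} → InSubs G A w u → x ∈ A → x ≢ w → ¬ Adj G u x
  subs-nonadjacent {u = u} (_ , indSwap) x∈A x≢w =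
    indSwap u _ (x∈p∪q⁺ (inj₂ (x∈⁅x⁆ u))) (x∈p∪q⁺ (inj₁ (x∈p∧x≢y⇒x∈p-y x∈A x≢w)))

  internallyActive? : ∀ A → Decidable (InternallyActive G A)
  internallyActive? A v = (v ∈? A) ×-dec
    all? (λ u → (dec G v u ×-dec independent? G ((A - v) ∪ ⁅ u ⁆)) →-dec (u <? v))

  nonActiveIsSingleton⊎allActive : ∀ {A v} → v ∈ A →
    (∀ w → w ∈ A → w ≢ v → InternallyActive G A w) →
    NonActiveIsSingleton G A v ⊎ AllActive G A
  nonActiveIsSingleton⊎allActive {A} {v} v∈A othersActive with internallyActive? A v
  ... | yes vActive = inj₂ λ w w∈A → active w w∈A (w ≟ v)
    where
    active : ∀ w → w ∈ A → Dec (w ≡ v) → InternallyActive G A w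
    active w _   (yes refl) = vActive
    active w w∈A (no w≢v)   = othersActive w w∈A w≢v
  ... | no ¬vActive = inj₁ λ w → mk⇔ (onlyV w) λ { refl → v∈A , ¬vActive }
    where
    onlyV : ∀ w → w ∈ A × ¬ InternallyActive G A w → w ≡ v
    onlyV w (w∈A , ¬wActive) with w ≟ v
    ... | yes w≡v = w≡v
    ... | no w≢v  = ⊥-elim (¬wActive (othersActive w w∈A w≢v))

  CoveredFromAbove : Fin n → Subset n → Set
  CoveredFromAbove v A = ∀ u → u ∉ A → Σ (Fin n) λ w → w ∈ A × Adj G u w × (w ≡ v ⊎ u < w)

  covered⇒maximal : ∀ {v A} → Independent G A → CoveredFromAbove v A → MaximalIndependent G A
  covered⇒maximal indA covered = indA , λ u u∉A indAu →
    let (w , w∈A , adj , _) = covered u u∉A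
    in indAu u w (x∈p∪q⁺ (inj₂ (x∈⁅x⁆ u))) (x∈p∪q⁺ (inj₁ w∈A)) adj

  covered⇒othersActive : ∀ {v A} → Independent G A → CoveredFromAbove v A →
    ∀ w → w ∈ A → w ≢ v → InternallyActive G A w
  covered⇒othersActive {A = A} indA covered w w∈A w≢v = w∈A , smaller
    where
    smaller : ∀ u → InSubs G A w u → u < w
    smaller u subs with covered u (subs-∉ indA w∈A subs)
    ... | w′ , w′∈A , adj , above with w′ ≟ w
    ... | no w′≢w = ⊥-elim (subs-nonadjacent subs w′∈A w′≢w adj)
    ... | yes refl with above
    ...   | inj₁ w≡v = ⊥-elim (w≢v w≡v)
    ...   | inj₂ u<w = u<w

  coveredIndependentThrough : ∀ v →
    Σ (Subset n) λ A → Independent G A × v ∈ A × CoveredFromAbove v A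
  coveredIndependentThrough v =
    A₀ ∪ ⁅ v ⁆ ,
    independent-∪⁅⁆ (independent greedy) (λ u u∈ → unblocked greedy u u∈ ∘ inj₂) ,
    x∈p∪q⁺ (inj₂ (x∈⁅x⁆ v)) ,
    covered
    where
    Blocked : Fin n → Set
    Blocked u = u ≡ v ⊎ Adj G v u

    greedyResult : Σ (Subset n) (GreedyIndependent G Blocked)
    greedyResult = greedyIndependent G (λ u → (u ≟ v) ⊎-dec dec G v u)

    A₀ : Subset n
    A₀ = proj₁ greedyResult

    greedy : GreedyIndependent G Blocked A₀
    greedy = proj₂ greedyResult

    covered : CoveredFromAbove v (A₀ ∪ ⁅ v ⁆)
    covered u u∉ with dominated greedy u (u∉ ∘ x∈p∪q⁺ ∘ inj₁)
    ... | inj₁ (inj₁ refl)           = ⊥-elim (u∉ (x∈p∪q⁺ (inj₂ (x∈⁅x⁆ v))))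
    ... | inj₁ (inj₂ adj)            = v , x∈p∪q⁺ (inj₂ (x∈⁅x⁆ v)) , sym G adj , inj₁ refl
    ... | inj₂ (w , w∈A₀ , adj , u<w) = w , x∈p∪q⁺ (inj₁ w∈A₀) , adj , inj₂ u<w

theorem6 : ∀ {n} (G : Graph n) → Connected G → (v : Fin n) →
    Σ (Subset n) (λ A → MaximalIndependent G A × v ∈ A ×
    (NonActiveIsSingleton G A v ⊎ AllActive G A))
theorem6 G _ v with coveredIndependentThrough G v
... | A , indA , v∈A , covered =
  A , covered⇒maximal G indA covered , v∈A ,
  nonActiveIsSingleton⊎allActive G v∈A (covered⇒othersActive G indA covered)
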